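{- For each positive integer $k$, there exists a class of finite structures (indeed of digraphs) that is decided by a non-adaptive left $k$-query algorithm over $\mathbb{N}$ but not by any adaptive left $(k-1)$-query algorithm over $\mathbb{N}$.
   Context: Structures are finite relational structures with non-empty domain of a fixed signature $\tau$; $\mathsf{FIN}(\tau)$ is the class of all of them; classes are closed under isomorphism; $\hom(F,A)$ is the number of homomorphisms $F\to A$. A non-adaptive left $k$-query algorithm over $\mathbb{N}$ is a pair $((F_1,\dots,F_k),X)$ with $F_i\in\mathsf{FIN}(\tau)$, $X\subseteq\mathbb{N}^k$; it decides $\{D:(\hom(F_1,D),\dots,\hom(F_k,D))\in X\}$. For a set $\Sigma$, $\Sigma^{<\omega}$ is the set of finite strings over $\Sigma$; a subtree is a prefix-closed subset, a leaf an element with no proper extension in it. An adaptive left query algorithm over $\mathbb{N}$ is a function $G:\mathcal{T}\to\mathsf{FIN}(\tau)\cup\{\mathsf{YES},\mathsf{NO}\}$ with $\mathcal{T}\subseteq\mathbb{N}^{<\omega}$ a subtree and $G(\sigma)\in\{\mathsf{YES},\mathsf{NO}\}$ iff $\sigma$ is a leaf; its computation path on $A$ is the limit of $\sigma_0=\varepsilon$, $\sigma_{i+1}=\sigma_i$ if $G(\sigma_i)\in\{\mathsf{YES},\mathsf{NO}\}$, else $\sigma_{i+1}=\sigma_i\bullet\hom(G(\sigma_i),A)$; it must halt on all inputs and decides $\{A:G(\text{path of }A)=\mathsf{YES}\}$. It is an adaptive left $j$-query algorithm if all computation paths have length at most $j$. -}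

module Defs where

open import Data.Nat using (ℕ; zero; suc; _+_)
open import Data.Fin using (Fin; zero; suc)
open import Data.Bool using (Bool; true; false; _∧_; if_then_else_)
open import Data.List using (List; []; _∷_; [_]; map; concatMap; allFin; foldr; _∷ʳ_)
open import Data.Vec using (Vec)
import Data.Vec as V
open import Relation.Binary.PropositionalEquality using (_≡_)
open import Data.Sum using (_⊎_)

-- The relation E is
-- given by its characteristic function (any finite relation is of this form).
record Digraph : Set where
  constructor digraph
  field
    pred-size : ℕ
    E : Fin (suc pred-size) → Fin (suc pred-size) → Bool

  size : ℕ
  size = suc pred-size

  V : Set
  V = Fin size

open Digraph public

Class : Set₁
Class = Digraph → Set

-- All functions Fin m → Fin n, enumerated (each exactly once).
consFun : {m n : ℕ} → Fin n → (Fin m → Fin n) → Fin (suc m) → Fin n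
consFun i f zero = i
consFun i f (suc x) = f x

allFuns : (m n : ℕ) → List (Fin m → Fin n)
allFuns zero n = [ (λ ()) ]
allFuns (suc m) n = concatMap (λ f → map (λ i → consFun i f) (allFin n)) (allFuns m n)

allᵇ : {A : Set} → (A → Bool) → List A → Bool
allᵇ p = foldr (λ a b → p a ∧ b) true

sumℕ : List ℕ → ℕ
sumℕ = foldr _+_ 0

_⇒ᵇ_ : Bool → Bool → Bool
true ⇒ᵇ b = b
false ⇒ᵇ b = true

isHom : (F A : Digraph) → (Fin (size F) → Fin (size A)) → Bool
isHom F A h =
  allᵇ (λ x → allᵇ (λ y → E F x y ⇒ᵇ E A (h x) (h y)) (allFin (size F))) (allFin (size F))

hom : Digraph → Digraph → ℕ
hom F A = sumℕ (map (λ h → if isHom F A h then 1 else 0) (allFuns (size F) (size A)))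

record NonAdaptive (k : ℕ) : Set₁ where
  constructor nonAdaptive
  field
    queries : Vec Digraph k
    X : Vec ℕ k → Set

homVec : {k : ℕ} → Vec Digraph k → Digraph → Vec ℕ k
homVec Fs D = V.map (λ F → hom F D) Fs

NADecides : {k : ℕ} → NonAdaptive k → Class → Set
NADecides (nonAdaptive Fs X) C = ∀ D → (C D → X (homVec Fs D)) × (X (homVec Fs D) → C D)
  where open import Data.Product using (_×_)

data Label : Set where
  query : Digraph → Label
  YES NO : Label

-- An adaptive left query algorithm: a labelling G of strings σ ∈ ℕ^{<ω}.
-- The subtree 𝒯 is implicitly {σ : every proper prefix of σ is labelled by a query};
-- its leaves are exactly the nodes labelled YES/NO; labels outside 𝒯 are irrelevant.
Adaptive : Set
Adaptive = List ℕ → Label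

path : Adaptive → Digraph → ℕ → List ℕ → List ℕ
path G A zero σ = σ
path G A (suc i) σ with G σ
... | query F = path G A i (σ ∷ʳ hom F A)
... | YES = σ
... | NO = σ

IsAnswer : Label → Set
IsAnswer l = (l ≡ YES) ⊎ (l ≡ NO)

-- G is an adaptive left j-query algorithm: every computation path has length ≤ j,
-- i.e. after at most j queries a leaf (YES/NO) is reached (so G halts on all inputs).
IsJQuery : ℕ → Adaptive → Set
IsJQuery j G = ∀ A → IsAnswer (G (path G A j []))

ADecides : ℕ → Adaptive → Class → Set
ADecides j G C = ∀ A → (C A → G (path G A j []) ≡ YES) × (G (path G A j []) ≡ YES → C A)
  where open import Data.Product using (_×_)

{-# OPTIONS --safe #-}
module Submission where

-- Let n = Q k, where Q 0 = 1 and Q (i + 1) = Q i · (Q i + 1), and let Cay g be the digraph on ℤ/n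
-- with edges x → x + g.  A homomorphism H → Cay g is a labelling of H increasing by g along edges,
-- and such labellings can be added and scaled.  Subtracting a fixed labelling matches the
-- homomorphisms into Cay g bijectively with those into Cay 0, so hom(H, Cay g) is 0 or hom(H, Cay 0).
-- The generators aⱼ = 1 + Q j (j < k) divide n and satisfy aₗ = 1 + R aⱼ for j < l.  So if H maps
-- to Cay 1 it maps to every Cay a, and if it maps to Cay aⱼ and Cay aₗ then hₗ - R hⱼ maps it to
-- Cay 1: every H has hom(H, Dⱼ) = hom(H, D₀) for all but at most one j, where Dⱼ = Cay aⱼ and
-- D₀ = Cay 1.  Run on D₀, an adaptive algorithm with k - 1 queries thus gets the same answers on
-- some Dⱼ.  But the class {A | hom(Dⱼ, A) = hom(Dⱼ, D₀) for all j}, decided by the k queries Dⱼ,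
-- contains D₀ and no Dⱼ: Dⱼ maps to itself, while the cycle of length n / aⱼ < n in Dⱼ cannot be
-- mapped into the n-cycle D₀.

open import Defs
open import Data.Bool using (Bool; true; false; T; if_then_else_)
open import Data.Bool.Properties using (T-∧)
open import Data.Empty using (⊥-elim)
open import Data.Fin as Fin using (Fin; zero; suc; toℕ)
open import Data.Fin.Permutation using (Permutation′; permutation; _⟨$⟩ʳ_; inverseˡ)
open import Data.Fin.Properties using (toℕ-fromℕ<; toℕ-injective; toℕ<n; pigeonhole; any?)
open import Data.List using (List; []; _∷_; _++_; _∷ʳ_; map; concatMap; allFin; tabulate; length; lookup)
open import Data.List.Membership.Propositional using (_∈_)
open import Data.List.Membership.Propositional.Properties using (∈-allFin)
open import Data.List.Properties using (map-++; map-cong; map-∘; map-tabulate)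
open import Data.List.Relation.Unary.All as All using (All; []; _∷_; all?)
open import Data.List.Relation.Unary.All.Properties using (tabulate⁺; tabulate⁻; ¬All⇒Any¬)
open import Data.List.Relation.Unary.Any as Any using (Any; here; there)
open import Data.List.Relation.Unary.Any.Properties using (lookup-index)
open import Data.Nat using (ℕ; zero; suc; pred; _+_; _*_; _≤_; _<_; _≥_; _∸_; z≤n; s≤s; z<s; _≟_; _<?_; NonZero; ≢-nonZero⁻¹; >-nonZero⁻¹)
open import Data.Nat.DivMod using (_%_; _mod_; %-distribˡ-+; %-distribˡ-*; m%n%n≡m%n; n%n≡0; m*n%n≡0; m%n<n; m<n⇒m%n≡m)
open import Data.Nat.Divisibility using (_∣_; divides; ∣-trans; m∣m*n; n∣m*n)
open import Data.Nat.ListAction.Properties using (sum-++)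
open import Data.Nat.Properties
open import Algebra.Properties.CommutativeSemigroup +-commutativeSemigroup using () renaming (interchange to +-interchange)
import Algebra.Properties.CommutativeMonoid.Sum +-0-commutativeMonoid as ℕ-Sum
open import Data.Product using (Σ; ∃; _×_; _,_; proj₁; proj₂)
open import Data.Sum using (_⊎_; inj₁; inj₂; [_,_]′)
open import Data.Unit using (tt)
import Data.Vec as Vec
open import Data.Vec.Properties using (lookup-map; lookup∘tabulate)
open import Function using (_∘_; id; _⇔_; mk⇔; Equivalence)
open import Relation.Binary using (_Preserves_⟶_; Setoid; IsEquivalence; Decidable)
open import Relation.Binary.PropositionalEquality
open import Relation.Nullary using (¬_; yes; no)
open import Relation.Nullary.Decidable using (⌊_⌋; map′; toWitness; fromWitness)
import Relation.Binary.Reasoning.Setoid as SetoidReasoning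

open Equivalence using (to; from)

-- Sums over lists and over all functions Fin m → Fin n

sum-map-cong : {A : Set} {w w′ : A → ℕ} → w ≗ w′ → (xs : List A) →
  sumℕ (map w xs) ≡ sumℕ (map w′ xs)
sum-map-cong w≗w′ xs = cong sumℕ (map-cong w≗w′ xs)

sum-map-concatMap : {A B : Set} (w : B → ℕ) (g : A → List B) (xs : List A) →
  sumℕ (map w (concatMap g xs)) ≡ sumℕ (map (λ x → sumℕ (map w (g x))) xs)
sum-map-concatMap w g [] = refl
sum-map-concatMap w g (x ∷ xs) = begin
  sumℕ (map w (g x ++ concatMap g xs))                ≡⟨ cong sumℕ (map-++ w (g x) _) ⟩
  sumℕ (map w (g x) ++ map w (concatMap g xs))        ≡⟨ sum-++ (map w (g x)) _ ⟩
  sumℕ (map w (g x)) + sumℕ (map w (concatMap g xs))  ≡⟨ cong (sumℕ (map w (g x)) +_) (sum-map-concatMap w g xs) ⟩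
  sumℕ (map w (g x)) + sumℕ (map (λ y → sumℕ (map w (g y))) xs)  ∎
  where open ≡-Reasoning

≤-sum-map : {A : Set} (w : A → ℕ) {x : A} {xs : List A} → x ∈ xs → w x ≤ sumℕ (map w xs)
≤-sum-map w {x} (here refl) = m≤m+n (w x) _
≤-sum-map w {xs = y ∷ _} (there x∈xs) = ≤-trans (≤-sum-map w x∈xs) (m≤n+m _ (w y))

sum-map-pos : {A : Set} (w : A → ℕ) (xs : List A) → 0 < sumℕ (map w xs) → ∃ λ x → 0 < w x
sum-map-pos w (x ∷ xs) pos with w x in wx≡
... | suc _ = x , subst (0 <_) (sym wx≡) z<s
... | zero  = sum-map-pos w xs pos

≮0⇒≡0 : ∀ {m} → ¬ 0 < m → m ≡ 0
≮0⇒≡0 = n≤0⇒n≡0 ∘ ≮⇒≥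

sum-tabulate : ∀ {n} (q : Fin n → ℕ) → sumℕ (tabulate q) ≡ ℕ-Sum.sum q
sum-tabulate {zero}  q = refl
sum-tabulate {suc n} q = cong (q zero +_) (sum-tabulate (q ∘ suc))

sum-allFin : ∀ {n} (q : Fin n → ℕ) → sumℕ (map q (allFin n)) ≡ ℕ-Sum.sum q
sum-allFin q = trans (cong sumℕ (map-tabulate id q)) (sum-tabulate q)

sum-allFin-permute : ∀ {n} (q : Fin n → ℕ) (π : Permutation′ n) →
  sumℕ (map (q ∘ (π ⟨$⟩ʳ_)) (allFin n)) ≡ sumℕ (map q (allFin n))
sum-allFin-permute q π = begin
  sumℕ (map (q ∘ (π ⟨$⟩ʳ_)) (allFin _))  ≡⟨ sum-allFin (q ∘ (π ⟨$⟩ʳ_)) ⟩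
  ℕ-Sum.sum (q ∘ (π ⟨$⟩ʳ_))             ≡⟨ ℕ-Sum.sum-permute q π ⟨
  ℕ-Sum.sum q                           ≡⟨ sum-allFin q ⟨
  sumℕ (map q (allFin _))               ∎
  where open ≡-Reasoning

consFun-η : ∀ {m n} (h : Fin (suc m) → Fin n) → h ≗ consFun (h zero) (h ∘ suc)
consFun-η h zero    = refl
consFun-η h (suc v) = refl

consFun-cong : ∀ {m n} (i : Fin n) {f g : Fin m → Fin n} → f ≗ g → consFun i f ≗ consFun i g
consFun-cong i f≗g zero    = refl
consFun-cong i f≗g (suc v) = f≗g v

sumOverHead : ∀ {m n} → ((Fin (suc m) → Fin n) → ℕ) → (Fin m → Fin n) → ℕ
sumOverHead {n = n} w f = sumℕ (map (λ i → w (consFun i f)) (allFin n))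

sumOverHead-cong : ∀ {m n} {w : (Fin (suc m) → Fin n) → ℕ} →
  w Preserves _≗_ ⟶ _≡_ → sumOverHead w Preserves _≗_ ⟶ _≡_
sumOverHead-cong {n = n} w-cong f≗g = sum-map-cong (λ i → w-cong (consFun-cong i f≗g)) (allFin n)

sum-allFuns-suc : ∀ m n (w : (Fin (suc m) → Fin n) → ℕ) →
  sumℕ (map w (allFuns (suc m) n)) ≡ sumℕ (map (sumOverHead w) (allFuns m n))
sum-allFuns-suc m n w = trans (sum-map-concatMap w _ (allFuns m n))
  (sum-map-cong (λ f → cong sumℕ (sym (map-∘ (allFin n)))) (allFuns m n))

≤-sum-allFuns : ∀ m n (w : (Fin m → Fin n) → ℕ) → w Preserves _≗_ ⟶ _≡_ →
  ∀ h → w h ≤ sumℕ (map w (allFuns m n))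
≤-sum-allFuns zero    n w w-cong h = ≤-trans (≤-reflexive (w-cong (λ ()))) (m≤m+n _ 0)
≤-sum-allFuns (suc m) n w w-cong h = begin
  w h                                       ≡⟨ w-cong (consFun-η h) ⟩
  w (consFun (h zero) (h ∘ suc))            ≤⟨ ≤-sum-map (λ i → w (consFun i (h ∘ suc))) (∈-allFin (h zero)) ⟩
  sumOverHead w (h ∘ suc)                   ≤⟨ ≤-sum-allFuns m n (sumOverHead w) (sumOverHead-cong w-cong) (h ∘ suc) ⟩
  sumℕ (map (sumOverHead w) (allFuns m n))  ≡⟨ sum-allFuns-suc m n w ⟨
  sumℕ (map w (allFuns (suc m) n))          ∎
  where open ≤-Reasoning

sum-allFuns-permute : ∀ m {n} (π : Fin m → Permutation′ n) (w : (Fin m → Fin n) → ℕ) →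
  w Preserves _≗_ ⟶ _≡_ →
  sumℕ (map w (allFuns m n)) ≡ sumℕ (map (λ h → w (λ v → π v ⟨$⟩ʳ h v)) (allFuns m n))
sum-allFuns-permute zero    π w w-cong = cong (_+ 0) (w-cong (λ ()))
sum-allFuns-permute (suc m) {n} π w w-cong = begin
  sumℕ (map w (allFuns (suc m) n))                    ≡⟨ sum-allFuns-suc m n w ⟩
  sumℕ (map (sumOverHead w) (allFuns m n))            ≡⟨ sum-allFuns-permute m (π ∘ suc) (sumOverHead w) (sumOverHead-cong w-cong) ⟩
  sumℕ (map (sumOverHead w ∘ πₛ) (allFuns m n))       ≡⟨ sum-map-cong permute-head (allFuns m n) ⟩
  sumℕ (map (sumOverHead (w ∘ π·)) (allFuns m n))     ≡⟨ sum-allFuns-suc m n (w ∘ π·) ⟨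
  sumℕ (map (w ∘ π·) (allFuns (suc m) n))             ∎
  where
  open ≡-Reasoning
  π· : (Fin (suc m) → Fin n) → (Fin (suc m) → Fin n)
  π· h v = π v ⟨$⟩ʳ h v
  πₛ : (Fin m → Fin n) → (Fin m → Fin n)
  πₛ f v = π (suc v) ⟨$⟩ʳ f v
  permute-head : sumOverHead w ∘ πₛ ≗ sumOverHead (w ∘ π·)
  permute-head f = begin
    sumℕ (map (λ i → w (consFun i (πₛ f))) (allFin n))               ≡⟨ sum-allFin-permute (λ i → w (consFun i (πₛ f))) (π zero) ⟨
    sumℕ (map (λ i → w (consFun (π zero ⟨$⟩ʳ i) (πₛ f))) (allFin n))  ≡⟨ sum-map-cong (λ i → w-cong (λ { zero → refl ; (suc v) → refl })) (allFin n) ⟩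
    sumℕ (map (λ i → w (π· (consFun i f))) (allFin n))              ∎

-- Counting homomorphisms

IsHomomorphism : (F A : Digraph) → (V F → V A) → Set
IsHomomorphism F A h = ∀ x y → T (E F x y) → T (E A (h x) (h y))

IsHomomorphism-cong : ∀ {F A} {h h′ : V F → V A} → h ≗ h′ →
  IsHomomorphism F A h → IsHomomorphism F A h′
IsHomomorphism-cong {A = A} h≗h′ φ x y exy = subst₂ (λ a b → T (E A a b)) (h≗h′ x) (h≗h′ y) (φ x y exy)

T-injective : ∀ {b c} → T b ⇔ T c → b ≡ c
T-injective {false} {false} _   = refl
T-injective {false} {true}  b⇔c = ⊥-elim (from b⇔c tt)
T-injective {true}  {false} b⇔c = ⊥-elim (to b⇔c tt)
T-injective {true}  {true}  _   = refl

T-⇒ᵇ : ∀ {b c} → T (b ⇒ᵇ c) ⇔ (T b → T c)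
T-⇒ᵇ {false} = mk⇔ (λ _ ()) (λ _ → tt)
T-⇒ᵇ {true}  = mk⇔ (λ t _ → t) (λ f → f tt)

T-allᵇ : {A : Set} (p : A → Bool) (xs : List A) → T (allᵇ p xs) ⇔ All (T ∘ p) xs
T-allᵇ p []       = mk⇔ (λ _ → []) (λ _ → tt)
T-allᵇ p (x ∷ xs) = mk⇔
  (λ t → let (px , pxs) = to T-∧ t in px ∷ to (T-allᵇ p xs) pxs)
  (λ { (px ∷ pxs) → from T-∧ (px , from (T-allᵇ p xs) pxs) })

T-allᵇ-allFin : ∀ {n} (p : Fin n → Bool) → T (allᵇ p (allFin n)) ⇔ (∀ i → T (p i))
T-allᵇ-allFin p = mk⇔ (tabulate⁻ ∘ to (T-allᵇ p _)) (from (T-allᵇ p _) ∘ tabulate⁺)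

T-isHom : ∀ F A h → T (isHom F A h) ⇔ IsHomomorphism F A h
T-isHom F A h = mk⇔
  (λ t x y → to T-⇒ᵇ (to (T-allᵇ-allFin _) (to (T-allᵇ-allFin _) t x) y))
  (λ φ → from (T-allᵇ-allFin _) λ x → from (T-allᵇ-allFin _) λ y → from T-⇒ᵇ (φ x y))

isHom-cong : ∀ F A B {h : V F → V A} {h′ : V F → V B} →
  IsHomomorphism F A h ⇔ IsHomomorphism F B h′ → isHom F A h ≡ isHom F B h′
isHom-cong F A B {h} {h′} φ⇔φ′ = T-injective (mk⇔
  (from (T-isHom F B h′) ∘ to φ⇔φ′ ∘ to (T-isHom F A h))
  (from (T-isHom F A h) ∘ from φ⇔φ′ ∘ to (T-isHom F B h′)))

homIndicator : (F A : Digraph) → (V F → V A) → ℕ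
homIndicator F A h = if isHom F A h then 1 else 0

homIndicator-cong : ∀ F A → homIndicator F A Preserves _≗_ ⟶ _≡_
homIndicator-cong F A h≗h′ = cong (if_then 1 else 0) (isHom-cong F A A
  (mk⇔ (IsHomomorphism-cong {F} {A} h≗h′) (IsHomomorphism-cong {F} {A} (sym ∘ h≗h′))))

homIndicator-pos⇔ : ∀ F A h → 0 < homIndicator F A h ⇔ IsHomomorphism F A h
homIndicator-pos⇔ F A h with isHom F A h | T-isHom F A h
... | true  | t⇔φ = mk⇔ (λ _ → to t⇔φ tt) (λ _ → z<s)
... | false | t⇔φ = mk⇔ (λ ()) (λ φ → ⊥-elim (from t⇔φ φ))

hom-pos : ∀ {F A h} → IsHomomorphism F A h → 0 < hom F A
hom-pos {F} {A} {h} φ = ≤-trans (from (homIndicator-pos⇔ F A h) φ)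
  (≤-sum-allFuns _ _ (homIndicator F A) (homIndicator-cong F A) h)

hom-pos⇒homomorphism : ∀ {F A} → 0 < hom F A → ∃ (IsHomomorphism F A)
hom-pos⇒homomorphism {F} {A} pos =
  let (h , h-pos) = sum-map-pos (homIndicator F A) (allFuns (size F) (size A)) pos
  in h , to (homIndicator-pos⇔ F A h) h-pos

hom-refl-pos : ∀ A → 0 < hom A A
hom-refl-pos A = hom-pos {A} {A} {id} (λ _ _ e → e)

hom-permute : ∀ F {p} (E₁ E₂ : Fin (suc p) → Fin (suc p) → Bool) (σ : V F → Permutation′ (suc p)) →
  (∀ h → IsHomomorphism F (digraph p E₁) h ⇔ IsHomomorphism F (digraph p E₂) (λ v → σ v ⟨$⟩ʳ h v)) →
  hom F (digraph p E₁) ≡ hom F (digraph p E₂)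
hom-permute F {p} E₁ E₂ σ σ-hom = begin
  sumℕ (map (homIndicator F A) (allFuns (size F) (suc p)))
    ≡⟨ sum-map-cong (λ h → cong (if_then 1 else 0) (isHom-cong F A B (σ-hom h))) (allFuns (size F) (suc p)) ⟩
  sumℕ (map (λ h → homIndicator F B (λ v → σ v ⟨$⟩ʳ h v)) (allFuns (size F) (suc p)))
    ≡⟨ sum-allFuns-permute (size F) σ (homIndicator F B) (homIndicator-cong F B) ⟨
  sumℕ (map (homIndicator F B) (allFuns (size F) (suc p)))
    ∎
  where
  open ≡-Reasoning
  A B : Digraph
  A = digraph p E₁
  B = digraph p E₂

-- Cayley digraphs of ℤ/n

module Cyclic (p : ℕ) where

  n : ℕ
  n = suc p

  infix 4 _≈_ _≈?_
  record _≈_ (a b : ℕ) : Set where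
    constructor mk≈
    field %-≡ : a % n ≡ b % n
  open _≈_

  ≈-isEquivalence : IsEquivalence _≈_
  ≈-isEquivalence = record
    { refl  = mk≈ refl
    ; sym   = λ a≈b → mk≈ (sym (%-≡ a≈b))
    ; trans = λ a≈b b≈c → mk≈ (trans (%-≡ a≈b) (%-≡ b≈c))
    }

  ≈-setoid : Setoid _ _
  ≈-setoid = record { isEquivalence = ≈-isEquivalence }

  open IsEquivalence ≈-isEquivalence public using () renaming (refl to ≈-refl; sym to ≈-sym; trans to ≈-trans)
  module ≈-Reasoning = SetoidReasoning ≈-setoid

  _≈?_ : Decidable _≈_
  a ≈? b = map′ mk≈ %-≡ (a % n ≟ b % n)

  ≡⇒≈ : ∀ {a b} → a ≡ b → a ≈ b
  ≡⇒≈ a≡b = mk≈ (cong (_% n) a≡b)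

  +-cong-≈ : ∀ {a a′ b b′} → a ≈ a′ → b ≈ b′ → a + b ≈ a′ + b′
  +-cong-≈ {a} {a′} {b} {b′} (mk≈ a≡a′) (mk≈ b≡b′) = mk≈ (begin
    (a + b) % n              ≡⟨ %-distribˡ-+ a b n ⟩
    (a % n + b % n) % n      ≡⟨ cong₂ (λ x y → (x + y) % n) a≡a′ b≡b′ ⟩
    (a′ % n + b′ % n) % n    ≡⟨ %-distribˡ-+ a′ b′ n ⟨
    (a′ + b′) % n            ∎)
    where open ≡-Reasoning

  +-congˡ-≈ : ∀ c {a b} → a ≈ b → c + a ≈ c + b
  +-congˡ-≈ c = +-cong-≈ (≈-refl {c})

  +-congʳ-≈ : ∀ c {a b} → a ≈ b → a + c ≈ b + c
  +-congʳ-≈ c a≈b = +-cong-≈ a≈b (≈-refl {c})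

  *-cong-≈ : ∀ {a a′ b b′} → a ≈ a′ → b ≈ b′ → a * b ≈ a′ * b′
  *-cong-≈ {a} {a′} {b} {b′} (mk≈ a≡a′) (mk≈ b≡b′) = mk≈ (begin
    (a * b) % n              ≡⟨ %-distribˡ-* a b n ⟩
    (a % n * (b % n)) % n    ≡⟨ cong₂ (λ x y → (x * y) % n) a≡a′ b≡b′ ⟩
    (a′ % n * (b′ % n)) % n  ≡⟨ %-distribˡ-* a′ b′ n ⟨
    (a′ * b′) % n            ∎)
    where open ≡-Reasoning

  n≈0 : n ≈ 0
  n≈0 = mk≈ (n%n≡0 n)

  n*≈0 : ∀ a → n * a ≈ 0
  n*≈0 a = mk≈ (trans (cong (_% n) (*-comm n a)) (m*n%n≡0 a n))

  +-cancelˡ-≈ : ∀ c {a b} → c + a ≈ c + b → a ≈ b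
  +-cancelˡ-≈ c {a} {b} c+a≈c+b = begin
    a                  ≈⟨ +-congʳ-≈ a (n*≈0 c) ⟨
    n * c + a          ≡⟨ regroup a ⟩
    p * c + (c + a)    ≈⟨ +-congˡ-≈ (p * c) c+a≈c+b ⟩
    p * c + (c + b)    ≡⟨ regroup b ⟨
    n * c + b          ≈⟨ +-congʳ-≈ b (n*≈0 c) ⟩
    b                  ∎
    where
    open ≈-Reasoning
    regroup : ∀ x → n * c + x ≡ p * c + (c + x)
    regroup x = trans (cong (_+ x) (+-comm c (p * c))) (+-assoc (p * c) c x)

  ≈⇒≡ : ∀ {a b} → a < n → b < n → a ≈ b → a ≡ b
  ≈⇒≡ a<n b<n (mk≈ a≡b) = trans (sym (m<n⇒m%n≡m a<n)) (trans a≡b (m<n⇒m%n≡m b<n))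

  toℕ-mod : ∀ a → toℕ (a mod n) ≈ a
  toℕ-mod a = mk≈ (trans (cong (_% n) (toℕ-fromℕ< (m%n<n a n))) (m%n%n≡m%n a n))

  Cay : ℕ → Digraph
  Cay g = digraph p (λ x y → ⌊ toℕ x + g ≈? toℕ y ⌋)

  Labelling : (H : Digraph) → ℕ → (V H → ℕ) → Set
  Labelling H g f = ∀ x y → T (E H x y) → f x + g ≈ f y

  labelling-cong : ∀ {H g g′} {f f′ : V H → ℕ} → g ≈ g′ → (∀ v → f v ≈ f′ v) →
    Labelling H g f → Labelling H g′ f′
  labelling-cong {g = g} {g′} {f} {f′} g≈g′ f≈f′ ℓ x y exy = begin
    f′ x + g′  ≈⟨ +-cong-≈ (f≈f′ x) g≈g′ ⟨
    f x + g    ≈⟨ ℓ x y exy ⟩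
    f y        ≈⟨ f≈f′ y ⟩
    f′ y       ∎
    where open ≈-Reasoning

  labelling-+ : ∀ {H g g′} {f f′ : V H → ℕ} → Labelling H g f → Labelling H g′ f′ →
    Labelling H (g + g′) (λ v → f v + f′ v)
  labelling-+ {g = g} {g′} {f} {f′} ℓ ℓ′ x y exy = begin
    f x + f′ x + (g + g′)    ≡⟨ +-interchange (f x) (f′ x) g g′ ⟩
    (f x + g) + (f′ x + g′)  ≈⟨ +-cong-≈ (ℓ x y exy) (ℓ′ x y exy) ⟩
    f y + f′ y               ∎
    where open ≈-Reasoning

  labelling-* : ∀ {H g} {f : V H → ℕ} c → Labelling H g f → Labelling H (c * g) (λ v → c * f v)
  labelling-* {g = g} {f} c ℓ x y exy = begin
    c * f x + c * g  ≡⟨ *-distribˡ-+ c (f x) g ⟨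
    c * (f x + g)    ≈⟨ *-cong-≈ (≈-refl {c}) (ℓ x y exy) ⟩
    c * f y          ∎
    where open ≈-Reasoning

  homomorphism⇔labelling : ∀ {H g} {h : V H → Fin n} →
    IsHomomorphism H (Cay g) h ⇔ Labelling H g (toℕ ∘ h)
  homomorphism⇔labelling = mk⇔ (λ φ x y exy → toWitness (φ x y exy)) (λ ℓ x y exy → fromWitness (ℓ x y exy))

  labelling⇒hom-pos : ∀ {H g} {f : V H → ℕ} → Labelling H g f → 0 < hom H (Cay g)
  labelling⇒hom-pos {H} {g} {f} ℓ = hom-pos {H} {Cay g} {λ v → f v mod n}
    (from (homomorphism⇔labelling {H} {g}) (labelling-cong (≈-refl {g}) (λ v → ≈-sym (toℕ-mod (f v))) ℓ))

  hom-pos⇒labelling : ∀ {H g} → 0 < hom H (Cay g) → ∃ (Labelling H g)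
  hom-pos⇒labelling {H} {g} pos =
    let (h , φ) = hom-pos⇒homomorphism {H} {Cay g} pos in toℕ ∘ h , to (homomorphism⇔labelling {H} {g}) φ

  translate : ℕ → Fin n → Fin n
  translate s z = (toℕ z + s) mod n

  translate-inverse : ∀ {s t} → s + t ≈ 0 → ∀ z → translate t (translate s z) ≡ z
  translate-inverse {s} {t} s+t≈0 z = toℕ-injective (≈⇒≡ (toℕ<n _) (toℕ<n z) (begin
    toℕ (translate t (translate s z))  ≈⟨ toℕ-mod _ ⟩
    toℕ (translate s z) + t            ≈⟨ +-congʳ-≈ t (toℕ-mod _) ⟩
    toℕ z + s + t                      ≡⟨ +-assoc (toℕ z) s t ⟩
    toℕ z + (s + t)                    ≈⟨ +-congˡ-≈ (toℕ z) s+t≈0 ⟩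
    toℕ z + 0                          ≡⟨ +-identityʳ (toℕ z) ⟩
    toℕ z                              ∎))
    where open ≈-Reasoning

  -- z ↦ z - a, written as z + p * a because p ≡ -1 (mod n)
  subtract : ℕ → Permutation′ n
  subtract a = permutation (translate (p * a)) (translate a)
    (translate-inverse (n*≈0 a))
    (translate-inverse (≈-trans (≡⇒≈ (+-comm (p * a) a)) (n*≈0 a)))

  hom-Cay≡hom-Cay0 : ∀ H {g} {f₀ : V H → ℕ} → Labelling H g f₀ → hom H (Cay g) ≡ hom H (Cay 0)
  hom-Cay≡hom-Cay0 H {g} {f₀} ℓ₀ = hom-permute H (E (Cay g)) (E (Cay 0)) σ
    (λ h → mk⇔ (forward h) (backward h))
    where
    σ : V H → Permutation′ n
    σ v = subtract (f₀ v)
    forward : ∀ h → IsHomomorphism H (Cay g) h → IsHomomorphism H (Cay 0) (λ v → σ v ⟨$⟩ʳ h v)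
    forward h φ = from (homomorphism⇔labelling {H} {0})
      (labelling-cong (n*≈0 g) (λ v → ≈-sym (toℕ-mod _))
        (labelling-+ (to (homomorphism⇔labelling {H} {g}) φ) (labelling-* p ℓ₀)))
    backward : ∀ h → IsHomomorphism H (Cay 0) (λ v → σ v ⟨$⟩ʳ h v) → IsHomomorphism H (Cay g) h
    backward h φ = from (homomorphism⇔labelling {H} {g})
      (labelling-cong (≈-refl {g}) (λ v → ≈-trans (≈-sym (toℕ-mod _)) (≡⇒≈ (cong toℕ (inverseˡ (σ v)))))
        (labelling-+ (to (homomorphism⇔labelling {H} {0}) φ) ℓ₀))

  hom-Cay≡hom-Cay1 : ∀ H → 0 < hom H (Cay 1) → ∀ a → hom H (Cay a) ≡ hom H (Cay 1)
  hom-Cay≡hom-Cay1 H H→Cay1 a = begin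
    hom H (Cay a)  ≡⟨ hom-Cay≡hom-Cay0 H ℓᵃ ⟩
    hom H (Cay 0)  ≡⟨ hom-Cay≡hom-Cay0 H ℓ₁ ⟨
    hom H (Cay 1)  ∎
    where
    open ≡-Reasoning
    f : V H → ℕ
    f = proj₁ (hom-pos⇒labelling {H} {1} H→Cay1)
    ℓ₁ : Labelling H 1 f
    ℓ₁ = proj₂ (hom-pos⇒labelling {H} {1} H→Cay1)
    ℓᵃ : Labelling H a (λ v → a * f v)
    ℓᵃ = labelling-cong (≡⇒≈ (*-identityʳ a)) (λ _ → ≈-refl) (labelling-* a ℓ₁)

  hom-Cay-dichotomy : ∀ H {a b} R → b ≈ 1 + R * a →
    hom H (Cay a) ≡ hom H (Cay 1) ⊎ hom H (Cay b) ≡ hom H (Cay 1)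
  hom-Cay-dichotomy H {a} {b} R b≈1+Ra
    with 0 <? hom H (Cay 1) | 0 <? hom H (Cay a) | 0 <? hom H (Cay b)
  ... | yes H→Cay1 | _ | _ = inj₁ (hom-Cay≡hom-Cay1 H H→Cay1 a)
  ... | no H↛Cay1 | no H↛Cayᵃ | _ = inj₁ (trans (≮0⇒≡0 H↛Cayᵃ) (sym (≮0⇒≡0 H↛Cay1)))
  ... | no H↛Cay1 | yes _ | no H↛Cayᵇ = inj₂ (trans (≮0⇒≡0 H↛Cayᵇ) (sym (≮0⇒≡0 H↛Cay1)))
  ... | no H↛Cay1 | yes H→Cayᵃ | yes H→Cayᵇ =
    let (_ , ℓᵃ) = hom-pos⇒labelling {H} {a} H→Cayᵃ
        (_ , ℓᵇ) = hom-pos⇒labelling {H} {b} H→Cayᵇ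
    in ⊥-elim (H↛Cay1 (labelling⇒hom-pos {H} {1}
         (labelling-cong b+pRa≈1 (λ _ → ≈-refl) (labelling-+ ℓᵇ (labelling-* (p * R) ℓᵃ)))))
    where
    b+pRa≈1 : b + p * R * a ≈ 1
    b+pRa≈1 = begin
      b + p * R * a              ≈⟨ +-congʳ-≈ (p * R * a) b≈1+Ra ⟩
      1 + R * a + p * R * a      ≡⟨ regroup ⟩
      1 + n * (R * a)            ≈⟨ +-congˡ-≈ 1 (n*≈0 (R * a)) ⟩
      1                          ∎
      where
      open ≈-Reasoning
      regroup : 1 + R * a + p * R * a ≡ 1 + n * (R * a)
      regroup = cong suc (cong (R * a +_) (*-assoc p R a))

  Cay-no-labelling-by-1 : ∀ {a m} → 0 < m → m < n → m * a ≈ 0 → ∀ {f} → ¬ Labelling (Cay a) 1 f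
  Cay-no-labelling-by-1 {a} {m} 0<m m<n ma≈0 {f} ℓ = <⇒≢ 0<m (sym m≡0)
    where
    walk : ℕ → Fin n
    walk i = (i * a) mod n
    step : ∀ i → T (E (Cay a) (walk i) (walk (suc i)))
    step i = fromWitness (begin
      toℕ (walk i) + a    ≈⟨ +-congʳ-≈ a (toℕ-mod (i * a)) ⟩
      i * a + a           ≡⟨ +-comm (i * a) a ⟩
      suc i * a           ≈⟨ toℕ-mod (suc i * a) ⟨
      toℕ (walk (suc i))  ∎)
      where open ≈-Reasoning
    climb : ∀ i → f (walk 0) + i ≈ f (walk i)
    climb zero    = ≡⇒≈ (+-identityʳ _)
    climb (suc i) = begin
      f (walk 0) + suc i    ≡⟨ trans (+-suc _ i) (+-comm 1 _) ⟩
      f (walk 0) + i + 1    ≈⟨ +-congʳ-≈ 1 (climb i) ⟩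
      f (walk i) + 1        ≈⟨ ℓ _ _ (step i) ⟩
      f (walk (suc i))      ∎
      where open ≈-Reasoning
    closed : walk m ≡ walk 0
    closed = toℕ-injective (≈⇒≡ (toℕ<n _) (toℕ<n _) (begin
      toℕ (walk m)  ≈⟨ toℕ-mod (m * a) ⟩
      m * a         ≈⟨ ma≈0 ⟩
      0             ≈⟨ toℕ-mod 0 ⟨
      toℕ (walk 0)  ∎))
      where open ≈-Reasoning
    m≡0 : m ≡ 0
    m≡0 = ≈⇒≡ m<n z<s (+-cancelˡ-≈ (f (walk 0)) (begin
      f (walk 0) + m  ≈⟨ climb m ⟩
      f (walk m)      ≡⟨ cong f closed ⟩
      f (walk 0)      ≡⟨ +-identityʳ _ ⟨
      f (walk 0) + 0  ∎))
      where open ≈-Reasoning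

  hom-Cay-Cay1≡0 : ∀ {a m} → 0 < m → m < n → m * a ≈ 0 → hom (Cay a) (Cay 1) ≡ 0
  hom-Cay-Cay1≡0 {a} 0<m m<n ma≈0 = ≮0⇒≡0 λ Cayₐ→Cay1 →
    Cay-no-labelling-by-1 0<m m<n ma≈0 (proj₂ (hom-pos⇒labelling {Cay a} {1} Cayₐ→Cay1))

-- Adaptive algorithms

queries : Adaptive → Digraph → ℕ → List ℕ → List Digraph
queries G A zero    σ = []
queries G A (suc i) σ with G σ
... | query F = F ∷ queries G A i (σ ∷ʳ hom F A)
... | YES     = []
... | NO      = []

length-queries : ∀ G A i σ → length (queries G A i σ) ≤ i
length-queries G A zero    σ = z≤n
length-queries G A (suc i) σ with G σ
... | query F = s≤s (length-queries G A i (σ ∷ʳ hom F A))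
... | YES     = z≤n
... | NO      = z≤n

path-cong : ∀ G {A B} i σ → All (λ F → hom F A ≡ hom F B) (queries G A i σ) →
  path G A i σ ≡ path G B i σ
path-cong G         zero    σ _ = refl
path-cong G {A} {B} (suc i) σ agree with G σ | agree
... | query F | F-agrees ∷ rest-agree =
  trans (path-cong G i (σ ∷ʳ hom F A) rest-agree) (cong (λ m → path G B i (σ ∷ʳ m)) F-agrees)
... | YES | _ = refl
... | NO  | _ = refl

module Adversary {k : ℕ} (D : Fin k → Digraph) (D₀ : Digraph)
  (separation : ∀ H {i j : Fin k} → i Fin.< j → hom H (D i) ≡ hom H D₀ ⊎ hom H (D j) ≡ hom H D₀)
  where

  AgreesOn : Fin k → Digraph → Set
  AgreesOn j H = hom H (D j) ≡ hom H D₀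

  distinct-disagreements : ∀ {Hs} (bad : ∀ j → Any (¬_ ∘ AgreesOn j) Hs) {i j} → i Fin.< j →
    Any.index (bad i) ≢ Any.index (bad j)
  distinct-disagreements {Hs} bad {i} {j} i<j same =
    [ lookup-index (bad i) , subst (¬_ ∘ AgreesOn j ∘ lookup Hs) (sym same) (lookup-index (bad j)) ]′
      (separation (lookup Hs (Any.index (bad i))) i<j)

  all-agree-somewhere : ∀ Hs → length Hs < k → ∃ λ j → All (AgreesOn j) Hs
  all-agree-somewhere Hs |Hs|<k with any? (λ j → all? (λ H → hom H (D j) ≟ hom H D₀) Hs)
  ... | yes found = found
  ... | no none =
    let bad j = ¬All⇒Any¬ (λ H → hom H (D j) ≟ hom H D₀) Hs (none ∘ (j ,_))
        (i , j , i<j , same) = pigeonhole |Hs|<k (Any.index ∘ bad)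
    in ⊥-elim (distinct-disagreements bad i<j same)

  indistinguishable : ∀ G i → i < k → ∃ λ j → path G D₀ i [] ≡ path G (D j) i []
  indistinguishable G i i<k =
    let (j , agree) = all-agree-somewhere (queries G D₀ i []) (≤-<-trans (length-queries G D₀ i []) i<k)
    in j , path-cong G i [] (All.map sym agree)

Q : ℕ → ℕ
Q zero    = 1
Q (suc i) = Q i * suc (Q i)

Q-nonZero : ∀ i → NonZero (Q i)
Q-nonZero zero    = _
Q-nonZero (suc i) = m*n≢0 (Q i) (suc (Q i)) {{Q-nonZero i}}

1+Q∣Q : ∀ {j l} → j < l → suc (Q j) ∣ Q l
1+Q∣Q {j} {suc l} j<1+l with m<1+n⇒m<n∨m≡n j<1+l
... | inj₁ j<l  = ∣-trans (1+Q∣Q j<l) (m∣m*n (suc (Q l)))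
... | inj₂ refl = n∣m*n (Q j)

1+Q≡1+R*[1+Q] : ∀ {j l} → j < l → ∃ λ R → suc (Q l) ≡ 1 + R * suc (Q j)
1+Q≡1+R*[1+Q] j<l with 1+Q∣Q j<l
... | divides R Ql≡R*[1+Qj] = R , cong suc Ql≡R*[1+Qj]

module Construction (k : ℕ) where

  open Cyclic (pred (Q k)) public

  n≡Q : n ≡ Q k
  n≡Q = suc-pred (Q k) {{Q-nonZero k}}

  D : Fin k → Digraph
  D j = Cay (suc (Q (toℕ j)))

  D₀ : Digraph
  D₀ = Cay 1

  separation : ∀ H {i j : Fin k} → i Fin.< j → hom H (D i) ≡ hom H D₀ ⊎ hom H (D j) ≡ hom H D₀
  separation H i<j = let (R , eq) = 1+Q≡1+R*[1+Q] i<j in hom-Cay-dichotomy H R (≡⇒≈ eq)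

  D↛D₀ : ∀ j → hom (D j) D₀ ≡ 0
  D↛D₀ j with 1+Q∣Q (toℕ<n j)
  ... | divides zero    Qk≡0     = ⊥-elim (≢-nonZero⁻¹ (Q k) {{Q-nonZero k}} Qk≡0)
  ... | divides (suc m) Qk≡m*a = hom-Cay-Cay1≡0 z<s 1+m<n (≈-trans (≡⇒≈ m*a≡n) n≈0)
    where
    a : ℕ
    a = suc (Q (toℕ j))
    m*a≡n : suc m * a ≡ n
    m*a≡n = sym (trans n≡Q Qk≡m*a)
    1+m<n : suc m < n
    1+m<n = subst (suc m <_) m*a≡n (m<m*n (suc m) a (s≤s (>-nonZero⁻¹ (Q (toℕ j)) {{Q-nonZero (toℕ j)}})))

lookup-homVec : ∀ {k} (D : Fin k → Digraph) A j → Vec.lookup (homVec (Vec.tabulate D) A) j ≡ hom (D j) A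
lookup-homVec D A j = trans (lookup-map j (λ F → hom F A) (Vec.tabulate D)) (cong (λ F → hom F A) (lookup∘tabulate D j))

theorem17 : (k : ℕ) → k ≥ 1 →
    Σ Class (λ C →
      Σ (NonAdaptive k) (λ P → NADecides P C)
      × ((G : Adaptive) → IsJQuery (k ∸ 1) G → ¬ ADecides (k ∸ 1) G C))
theorem17 (suc k) _ = C , (nonAdaptive Fs (_≡ homVec Fs D₀) , λ _ → id , id) , lower-bound
  where
  open Construction (suc k)
  Fs : Vec.Vec Digraph (suc k)
  Fs = Vec.tabulate D
  C : Class
  C A = homVec Fs A ≡ homVec Fs D₀
  -- ADecides k already runs G for only k steps.
  lower-bound : (G : Adaptive) → IsJQuery k G → ¬ ADecides k G C
  lower-bound G _ decides =
    let (j , same-path) = Adversary.indistinguishable D D₀ separation G k (n<1+n k)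
        D₀-accepted : G (path G D₀ k []) ≡ YES
        D₀-accepted = proj₁ (decides D₀) refl
        Dj∈C : C (D j)
        Dj∈C = proj₂ (decides (D j)) (trans (cong G (sym same-path)) D₀-accepted)
        Dj→Dj≡Dj→D₀ : hom (D j) (D j) ≡ hom (D j) D₀
        Dj→Dj≡Dj→D₀ = begin
          hom (D j) (D j)                    ≡⟨ lookup-homVec D (D j) j ⟨
          Vec.lookup (homVec Fs (D j)) j     ≡⟨ cong (λ v → Vec.lookup v j) Dj∈C ⟩
          Vec.lookup (homVec Fs D₀) j        ≡⟨ lookup-homVec D D₀ j ⟩
          hom (D j) D₀                       ∎
    in <⇒≢ (hom-refl-pos (D j)) (sym (trans Dj→Dj≡Dj→D₀ (D↛D₀ j)))
    where open ≡-Reasoning
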